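{- Let $S^\#$ be a computable presentation of a cancellative abelian semigroup $S$, and let $\mathcal{G}(S^\#)$ be an $S^\#$-universal c.e. presentation of the Grothendieck group $\mathcal{G}(S)$. Then $\mathcal{G}(S^\#)$ is computable.
   Context: Let $D_\omega$, $F_\omega$ be the free semigroup and free group on $x_0,x_1,\ldots$, computably identified with $\mathbb{N}$. A presentation of a semigroup $S$ (resp. group $G$) is an epimorphism $\nu:D_\omega\to S$ (resp. $\nu:F_\omega\to G$); $w$ is a label of $\nu(w)$; it is c.e. (computable) if $\{(w,w'):\nu(w)=\nu(w')\}$ is c.e. (computable). A homomorphism $f$ is a computable map between presentations if a computable function on words sends each label of $a$ to a label of $f(a)$. $\mathcal{G}(S)$ is the Grothendieck group $(S\times S)/\!\sim$ where $(a,b)\sim(c,d)$ iff $a+d+z=c+b+z$ for some $z\in S$, with canonical map $\gamma_S(a)=[(a+b,b)]$. A presentation of $\mathcal{G}(S)$ is $S^\#$-universal if $\gamma_S$ is a computable map from $S^\#$ to it, and whenever $H^\#$ is a c.e. presentation of an abelian group and $\phi$ is a computable semigroup homomorphism from $S^\#$ to $H^\#$, the unique group homomorphism $\psi_\phi$ with $\psi_\phi\circ\gamma_S=\phi$ is computable, with index computable from an index of $\phi$ (such a c.e. presentation exists for c.e. $S^\#$ and is unique up to computable isomorphism). -}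

module Defs where

open import Level using (0ℓ)
open import Data.Nat using (ℕ; zero; suc; _+_; _*_; _<_)
open import Data.Bool using (Bool; true; false)
open import Data.Product using (Σ; ∃; _×_; _,_; proj₁; proj₂)
open import Data.Sum using (_⊎_)
open import Data.List using (List; []; _∷_; _++_)
open import Data.List.NonEmpty using (List⁺; _∷_; _⁺++⁺_)
open import Relation.Nullary using (¬_)
open import Algebra.Bundles using (CommutativeSemigroup; AbelianGroup)
open import Algebra.Bundles.Raw using (RawGroup)

-- A model of computation: partial recursive functions ℕ ⇀ ℕ,
-- with multiple arguments handled through the Cantor pairing function.

tri : ℕ → ℕ
tri zero = zero
tri (suc n) = suc n + tri n

⟪_,_⟫ : ℕ → ℕ → ℕ
⟪ x , y ⟫ = tri (x + y) + y

data Code : Set where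
  cZero cSucc cFst cSnd : Code
  cPair cComp cRec : Code → Code → Code
  cMu : Code → Code

data Eval : Code → ℕ → ℕ → Set where
  eZero : ∀ {x} → Eval cZero x 0
  eSucc : ∀ {x} → Eval cSucc x (suc x)
  eFst  : ∀ {x y} → Eval cFst ⟪ x , y ⟫ x
  eSnd  : ∀ {x y} → Eval cSnd ⟪ x , y ⟫ y
  ePair : ∀ {f g x a b} → Eval f x a → Eval g x b → Eval (cPair f g) x ⟪ a , b ⟫
  -- cComp f g = f ∘ g
  eComp : ∀ {f g x y z} → Eval g x y → Eval f y z → Eval (cComp f g) x z
  -- primitive recursion with parameter x on the second component
  eRec0 : ∀ {f g x a} → Eval f x a → Eval (cRec f g) ⟪ x , 0 ⟫ a
  eRecS : ∀ {f g x n a b} → Eval (cRec f g) ⟪ x , n ⟫ a →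
          Eval g ⟪ ⟪ x , n ⟫ , a ⟫ b → Eval (cRec f g) ⟪ x , suc n ⟫ b
  eMu   : ∀ {f x n} → Eval f ⟪ x , n ⟫ 0 →
          (∀ m → m < n → Σ ℕ (λ k → Eval f ⟪ x , m ⟫ (suc k))) →
          Eval (cMu f) x n

⌜_⌝ : Code → ℕ
⌜ cZero ⌝ = ⟪ 0 , 0 ⟫
⌜ cSucc ⌝ = ⟪ 1 , 0 ⟫
⌜ cFst ⌝ = ⟪ 2 , 0 ⟫
⌜ cSnd ⌝ = ⟪ 3 , 0 ⟫
⌜ cPair f g ⌝ = ⟪ 4 , ⟪ ⌜ f ⌝ , ⌜ g ⌝ ⟫ ⟫
⌜ cComp f g ⌝ = ⟪ 5 , ⟪ ⌜ f ⌝ , ⌜ g ⌝ ⟫ ⟫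
⌜ cRec f g ⌝ = ⟪ 6 , ⟪ ⌜ f ⌝ , ⌜ g ⌝ ⟫ ⟫
⌜ cMu f ⌝ = ⟪ 7 , ⌜ f ⌝ ⟫

DWord : Set
DWord = List⁺ ℕ

-- F_ω : group words over x_i^{±1}; (i , true) = x_i, (i , false) = x_i⁻¹
FWord : Set
FWord = List (ℕ × Bool)

bit : Bool → ℕ
bit true = 1
bit false = 0

codeL : List ℕ → ℕ
codeL [] = 0
codeL (x ∷ xs) = suc ⟪ x , codeL xs ⟫

codeD : DWord → ℕ
codeD (x ∷ xs) = ⟪ x , codeL xs ⟫

codeF : FWord → ℕ
codeF [] = 0
codeF ((i , b) ∷ w) = suc ⟪ 2 * i + bit b , codeF w ⟫

IsCERel : {W : Set} → (W → ℕ) → (W → W → Set) → Set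
IsCERel {W} code R = Σ Code λ e → ∀ (u v : W) →
  (R u v → Σ ℕ λ m → Eval e ⟪ code u , code v ⟫ m) ×
  (Σ ℕ (λ m → Eval e ⟪ code u , code v ⟫ m) → R u v)

IsComputableRel : {W : Set} → (W → ℕ) → (W → W → Set) → Set
IsComputableRel {W} code R = Σ Code λ e → ∀ (u v : W) →
  (R u v × Eval e ⟪ code u , code v ⟫ 0) ⊎ (¬ R u v × Eval e ⟪ code u , code v ⟫ 1)

IsIndexOf : {W W' A B : Set} → (W → ℕ) → (W' → ℕ) → (W → A) → (W' → B) →
            (B → B → Set) → (A → B) → Code → Set
IsIndexOf {W} {W'} code code' ν ν' _≈'_ f e = ∀ (w : W) →
  Σ W' λ w' → Eval e (code w) (code' w') × (ν' w' ≈' f (ν w))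

record SemigroupPresentation (S : CommutativeSemigroup 0ℓ 0ℓ) : Set where
  open CommutativeSemigroup S
  field
    ν    : DWord → Carrier
    hom  : ∀ u v → ν (u ⁺++⁺ v) ≈ ν u ∙ ν v
    surj : ∀ a → Σ DWord λ w → ν w ≈ a

-- presentation F_ω → G, G given by its (raw) group operations;
-- ν is a monoid homomorphism on words sending x_i⁻¹ to (x_i)⁻¹,
-- i.e. it is the composite of reduction with a homomorphism F_ω → G.
record GroupPresentation (G : RawGroup 0ℓ 0ℓ) : Set where
  open RawGroup G
  field
    ν    : FWord → Carrier
    hom-ε : ν [] ≈ ε
    hom  : ∀ u v → ν (u ++ v) ≈ ν u ∙ ν v
    hom-inv : ∀ i → ν ((i , false) ∷ []) ≈ (ν ((i , true) ∷ [])) ⁻¹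
    surj : ∀ g → Σ FWord λ w → ν w ≈ g

Cancellative : CommutativeSemigroup 0ℓ 0ℓ → Set
Cancellative S = ∀ a b c → a ∙ c ≈ b ∙ c → a ≈ b
  where open CommutativeSemigroup S

module Grothendieck (S : CommutativeSemigroup 0ℓ 0ℓ) where
  open CommutativeSemigroup S

  _∼_ : Carrier × Carrier → Carrier × Carrier → Set
  (a , b) ∼ (c , d) = Σ Carrier λ z → (a ∙ d) ∙ z ≈ (c ∙ b) ∙ z

  _⊕_ : Carrier × Carrier → Carrier × Carrier → Carrier × Carrier
  (a , b) ⊕ (c , d) = (a ∙ c , b ∙ d)

  ⊖_ : Carrier × Carrier → Carrier × Carrier
  ⊖ (a , b) = (b , a)

  -- canonical map γ_S(a) = [(a + b , b)], taking b = a
  γ : Carrier → Carrier × Carrier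
  γ a = (a ∙ a , a)

  -- 𝒢(S) as a raw group on S × S modulo ∼; the neutral element is the
  -- class [(s₀ , s₀)] (independent of the chosen s₀ ∈ S)
  𝒢 : Carrier → RawGroup 0ℓ 0ℓ
  𝒢 s₀ = record
    { Carrier = Carrier × Carrier
    ; _≈_ = _∼_
    ; _∙_ = _⊕_
    ; ε = (s₀ , s₀)
    ; _⁻¹ = ⊖_
    }

-- the Grothendieck group of S, with neutral element taken from the
-- presentation (S is nonempty since it is presented)
𝒢of : (S : CommutativeSemigroup 0ℓ 0ℓ) → SemigroupPresentation S → RawGroup 0ℓ 0ℓ
𝒢of S P = Grothendieck.𝒢 S (SemigroupPresentation.ν P (0 ∷ []))

IsCESemigroupPres : {S : CommutativeSemigroup 0ℓ 0ℓ} → SemigroupPresentation S → Set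
IsCESemigroupPres {S} P = IsCERel codeD (λ u v → ν u ≈ ν v)
  where open CommutativeSemigroup S
        open SemigroupPresentation P

IsComputableSemigroupPres : {S : CommutativeSemigroup 0ℓ 0ℓ} → SemigroupPresentation S → Set
IsComputableSemigroupPres {S} P = IsComputableRel codeD (λ u v → ν u ≈ ν v)
  where open CommutativeSemigroup S
        open SemigroupPresentation P

IsCEGroupPres : {G : RawGroup 0ℓ 0ℓ} → GroupPresentation G → Set
IsCEGroupPres {G} P = IsCERel codeF (λ u v → ν u ≈ ν v)
  where open RawGroup G
        open GroupPresentation P

IsComputableGroupPres : {G : RawGroup 0ℓ 0ℓ} → GroupPresentation G → Set
IsComputableGroupPres {G} P = IsComputableRel codeF (λ u v → ν u ≈ ν v)
  where open RawGroup G
        open GroupPresentation P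

IsSemigroupHom : (S : CommutativeSemigroup 0ℓ 0ℓ) (H : AbelianGroup 0ℓ 0ℓ) →
                 (CommutativeSemigroup.Carrier S → AbelianGroup.Carrier H) → Set
IsSemigroupHom S H φ =
  (∀ a b → a ≈S b → φ a ≈H φ b) × (∀ a b → φ (a ∙S b) ≈H φ a ∙H φ b)
  where open CommutativeSemigroup S renaming (_≈_ to _≈S_; _∙_ to _∙S_)
        open AbelianGroup H renaming (_≈_ to _≈H_; _∙_ to _∙H_)

IsGroupHomFrom𝒢 : (S : CommutativeSemigroup 0ℓ 0ℓ) (H : AbelianGroup 0ℓ 0ℓ) →
                  (CommutativeSemigroup.Carrier S × CommutativeSemigroup.Carrier S →
                   AbelianGroup.Carrier H) → Set
IsGroupHomFrom𝒢 S H ψ =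
  (∀ p q → p ∼ q → ψ p ≈H ψ q) × (∀ p q → ψ (p ⊕ q) ≈H ψ p ∙H ψ q)
  where open Grothendieck S
        open AbelianGroup H renaming (_≈_ to _≈H_; _∙_ to _∙H_)

IsUniversal : (S : CommutativeSemigroup 0ℓ 0ℓ) (PS : SemigroupPresentation S) →
              GroupPresentation (𝒢of S PS) → Set₁
IsUniversal S PS PG =
  (Σ Code λ e → IsIndexOf codeD codeF (SemigroupPresentation.ν PS)
                           (GroupPresentation.ν PG) _∼_ γ e)
  ×
  (∀ (H : AbelianGroup 0ℓ 0ℓ) (PH : GroupPresentation (AbelianGroup.rawGroup H)) →
     IsCEGroupPres PH →
     Σ Code λ u →
       ∀ (φ : CommutativeSemigroup.Carrier S → AbelianGroup.Carrier H) →
       IsSemigroupHom S H φ →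
       ∀ (e : Code) →
       IsIndexOf codeD codeF (SemigroupPresentation.ν PS) (GroupPresentation.ν PH)
                 (AbelianGroup._≈_ H) φ e →
       ∀ (ψ : CommutativeSemigroup.Carrier S × CommutativeSemigroup.Carrier S →
              AbelianGroup.Carrier H) →
       IsGroupHomFrom𝒢 S H ψ →
       (∀ a → AbelianGroup._≈_ H (ψ (γ a)) (φ a)) →
       Σ Code λ e' → Eval u ⌜ e ⌝ ⌜ e' ⌝ ×
         IsIndexOf codeF codeF (GroupPresentation.ν PG) (GroupPresentation.ν PH)
                   (AbelianGroup._≈_ H) ψ e')
  where open Grothendieck S

module Submission where

-- Since S is cancellative, 𝒢(S) has a computable presentation of its own, sending x_i to γ(ν x_i):
-- to compare two group words u and v, collect the positive letters of v and the negative letters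
-- of u into one semigroup word, the negative letters of v and the positive letters of u into
-- another; u and v name the same element iff the two words name the same element of S, which the
-- computable S^# decides. Universality, applied to φ = γ, yields a computable map from 𝒢(S^#) to
-- this presentation that is the identity of 𝒢(S), so equality in 𝒢(S^#) reduces to it.

open import Level using (0ℓ)
open import Algebra.Bundles using (CommutativeSemigroup; AbelianGroup)
open import Data.Bool using (Bool; true; false)
open import Data.Empty using (⊥-elim)
open import Data.List using (List; []; _∷_; _++_; length; foldl; map)
open import Data.List.NonEmpty using (_∷_)
open import Data.Nat using (ℕ; zero; suc; _+_; _*_; _≤_; z≤n; s≤s)
open import Data.Nat.Properties
open import Data.Nat.GeneralisedArithmetic using (fold; iterate; iterate-is-fold)
open import Data.Product using (Σ; _×_; _,_; proj₁; proj₂; swap)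
open import Data.Sum using (_⊎_; inj₁; inj₂)
open import Function using (id; _⇔_; mk⇔; Equivalence)
open import Relation.Binary.Definitions using (tri<; tri≈; tri>)
open import Relation.Binary.Structures using (IsEquivalence)
open import Relation.Nullary using (¬_)

open import Defs

module CantorPairing where

  open import Relation.Binary.PropositionalEquality

  pair-sucʳ : ∀ x y → ⟪ x , suc y ⟫ ≡ suc ⟪ suc x , y ⟫
  pair-sucʳ x y rewrite +-suc x y | +-suc (tri (suc (x + y))) y = refl

  pair-suc-zero : ∀ x → ⟪ suc x , 0 ⟫ ≡ suc ⟪ 0 , x ⟫
  pair-suc-zero x rewrite +-identityʳ x | +-identityʳ (x + tri x) = cong suc (+-comm x (tri x))

  -- enumerates each diagonal x + y = d from (d , 0) to (0 , d)
  unpair : ℕ → ℕ × ℕ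
  unpair zero = 0 , 0
  unpair (suc n) with unpair n
  ... | zero , y = suc y , 0
  ... | suc x , y = x , suc y

  pair-unpair : ∀ n → ⟪ proj₁ (unpair n) , proj₂ (unpair n) ⟫ ≡ n
  pair-unpair zero = refl
  pair-unpair (suc n) with unpair n | pair-unpair n
  ... | zero , y | eq = trans (pair-suc-zero y) (cong suc eq)
  ... | suc x , y | eq = trans (pair-sucʳ x y) (cong suc eq)

  unpair-pair′ : ∀ n x y → ⟪ x , y ⟫ ≡ n → unpair n ≡ (x , y)
  unpair-pair′ zero zero zero _ = refl
  unpair-pair′ zero (suc x) zero e = ⊥-elim (1+n≢0 (trans (sym (pair-suc-zero x)) e))
  unpair-pair′ zero x (suc y) e = ⊥-elim (1+n≢0 (trans (sym (pair-sucʳ x y)) e))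
  unpair-pair′ (suc n) (suc x) zero e
    rewrite unpair-pair′ n 0 x (suc-injective (trans (sym (pair-suc-zero x)) e)) = refl
  unpair-pair′ (suc n) x (suc y) e
    rewrite unpair-pair′ n (suc x) y (suc-injective (trans (sym (pair-sucʳ x y)) e)) = refl

  unpair-pair : ∀ x y → unpair ⟪ x , y ⟫ ≡ (x , y)
  unpair-pair x y = unpair-pair′ _ x y refl

  pair-injective : ∀ {x y x′ y′} → ⟪ x , y ⟫ ≡ ⟪ x′ , y′ ⟫ → x ≡ x′ × y ≡ y′
  pair-injective {x} {y} {x′} {y′} e
    with trans (sym (unpair-pair x y)) (trans (cong unpair e) (unpair-pair x′ y′))
  ... | refl = refl , refl

  fst snd : ℕ → ℕ
  fst n = proj₁ (unpair n)
  snd n = proj₂ (unpair n)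

  snd≤pair : ∀ x y → y ≤ ⟪ x , y ⟫
  snd≤pair x y = m≤n+m y (tri (x + y))

module Computability where

  open import Relation.Binary.PropositionalEquality

  open CantorPairing

  Eval-deterministic : ∀ {e x y y′} → Eval e x y → Eval e x y′ → y ≡ y′
  Eval-deterministic = go refl
    where
    go : ∀ {e x x′ y y′} → x ≡ x′ → Eval e x y → Eval e x′ y′ → y ≡ y′
    go eq eZero eZero = refl
    go eq eSucc eSucc = cong suc eq
    go eq (eFst {x} {y}) (eFst {x′} {y′}) = proj₁ (pair-injective {x} {y} {x′} {y′} eq)
    go eq (eSnd {x} {y}) (eSnd {x′} {y′}) = proj₂ (pair-injective {x} {y} {x′} {y′} eq)
    go eq (ePair a b) (ePair a′ b′) = cong₂ ⟪_,_⟫ (go eq a a′) (go eq b b′)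
    go eq (eComp a b) (eComp a′ b′) = go (go eq a a′) b b′
    go eq (eRec0 {x = x} a) (eRec0 {x = x′} a′) = go (proj₁ (pair-injective {x} {0} {x′} {0} eq)) a a′
    go eq (eRec0 {x = x} a) (eRecS {x = x′} {n′} a′ b′)
      with () ← proj₂ (pair-injective {x} {0} {x′} {suc n′} eq)
    go eq (eRecS {x = x} {n} a b) (eRec0 {x = x′} a′)
      with () ← proj₂ (pair-injective {x} {suc n} {x′} {0} eq)
    go eq (eRecS {x = x} {n} a b) (eRecS {x = x′} {n′} a′ b′)
      with pair-injective {x} {suc n} {x′} {suc n′} eq
    ... | refl , refl = go (cong ⟪ ⟪ x , n ⟫ ,_⟫ (go refl a a′)) b b′
    go refl (eMu {n = m} a h) (eMu {n = m′} a′ h′) with <-cmp m m′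
    ... | tri≈ _ m≡m′ _ = m≡m′
    ... | tri< m<m′ _ _ = ⊥-elim (1+n≢0 (sym (go refl a (proj₂ (h′ m m<m′)))))
    ... | tri> _ _ m′<m = ⊥-elim (1+n≢0 (go refl (proj₂ (h m′ m′<m)) a′))

  computable⇒ce : {W : Set} {code : W → ℕ} {R : W → W → Set} →
                  IsComputableRel code R → IsCERel code R
  computable⇒ce {code = code} {R} (d , decides) = cMu (cComp d cFst) , λ u v → halts u v , sound u v
    where
    halts : ∀ u v → R u v → Σ ℕ (λ m → Eval (cMu (cComp d cFst)) ⟪ code u , code v ⟫ m)
    halts u v r with decides u v
    ... | inj₁ (_ , d≡0) = 0 , eMu (eComp (eFst {⟪ code u , code v ⟫} {0}) d≡0) (λ _ ())
    ... | inj₂ (¬r , _) = ⊥-elim (¬r r)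
    accepted : ∀ u v → Eval d ⟪ code u , code v ⟫ 0 → R u v
    accepted u v d≡0 with decides u v
    ... | inj₁ (r , _) = r
    ... | inj₂ (_ , d≡1) with () ← Eval-deterministic d≡0 d≡1
    sound : ∀ u v → Σ ℕ (λ m → Eval (cMu (cComp d cFst)) ⟪ code u , code v ⟫ m) → R u v
    sound u v (m , eMu (eComp fst-eval d≡0) _) =
      accepted u v (subst (λ x → Eval d x 0) (Eval-deterministic fst-eval (eFst {⟪ code u , code v ⟫} {m})) d≡0)

  computable-by-reduction :
    {W W′ : Set} {code : W → ℕ} {code′ : W′ → ℕ} {R : W → W → Set} {R′ : W′ → W′ → Set} →
    IsComputableRel code′ R′ → (t : Code) →
    (∀ u v → Σ W′ λ u′ → Σ W′ λ v′ →
             Eval t ⟪ code u , code v ⟫ ⟪ code′ u′ , code′ v′ ⟫ × (R u v ⇔ R′ u′ v′)) →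
    IsComputableRel code R
  computable-by-reduction {code = code} {R = R} (d , decides) t reduces = cComp d t , decide
    where
    decide : ∀ u v → (R u v × Eval (cComp d t) ⟪ code u , code v ⟫ 0) ⊎
                     (¬ R u v × Eval (cComp d t) ⟪ code u , code v ⟫ 1)
    decide u v with reduces u v
    ... | u′ , v′ , t-eval , R⇔R′ with decides u′ v′
    ...   | inj₁ (r′ , d≡0) = inj₁ (Equivalence.from R⇔R′ r′ , eComp t-eval d≡0)
    ...   | inj₂ (¬r′ , d≡1) = inj₂ ((λ r → ¬r′ (Equivalence.to R⇔R′ r)) , eComp t-eval d≡1)

  computable-along-identity :
    {W W′ A : Set} {code : W → ℕ} {code′ : W′ → ℕ} {ν : W → A} {ν′ : W′ → A}
    {_≈_ : A → A → Set} →
    IsEquivalence _≈_ → IsComputableRel code′ (λ u v → ν′ u ≈ ν′ v) →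
    (e : Code) → IsIndexOf code code′ ν ν′ _≈_ id e → IsComputableRel code (λ u v → ν u ≈ ν v)
  computable-along-identity {W} {W′} {A} {code} {code′} {ν} {ν′} {_≈_} isEquivalence computable′ e index =
    computable-by-reduction {code = code} {code′ = code′} computable′ t reduces
    where
    module ≈ = IsEquivalence isEquivalence
    t : Code
    t = cPair (cComp e cFst) (cComp e cSnd)
    reduces : ∀ u v → Σ W′ λ u′ → Σ W′ λ v′ →
              Eval t ⟪ code u , code v ⟫ ⟪ code′ u′ , code′ v′ ⟫ × (ν u ≈ ν v ⇔ ν′ u′ ≈ ν′ v′)
    reduces u v with index u | index v
    ... | u′ , eval-u′ , u′≈u | v′ , eval-v′ , v′≈v =
      u′ , v′ , ePair (eComp (eFst {code u} {code v}) eval-u′) (eComp (eSnd {code u} {code v}) eval-v′) ,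
      mk⇔ (λ u≈v → ≈.trans u′≈u (≈.trans u≈v (≈.sym v′≈v)))
          (λ u′≈v′ → ≈.trans (≈.sym u′≈u) (≈.trans u′≈v′ v′≈v))

  Computes : Code → (ℕ → ℕ) → Set
  Computes e f = ∀ n → Eval e n (f n)

  computes-zero : Computes cZero (λ _ → 0)
  computes-zero _ = eZero

  computes-suc : Computes cSucc suc
  computes-suc _ = eSucc

  computes-fst : Computes cFst fst
  computes-fst n = subst (λ m → Eval cFst m (fst n)) (pair-unpair n) (eFst {fst n} {snd n})

  computes-snd : Computes cSnd snd
  computes-snd n = subst (λ m → Eval cSnd m (snd n)) (pair-unpair n) (eSnd {fst n} {snd n})

  computes-pair : ∀ {e e′ f g} → Computes e f → Computes e′ g →
                  Computes (cPair e e′) (λ n → ⟪ f n , g n ⟫)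
  computes-pair c c′ n = ePair (c n) (c′ n)

  computes-∘ : ∀ {e e′ f g} → Computes e f → Computes e′ g → Computes (cComp e e′) (λ n → f (g n))
  computes-∘ c c′ n = eComp (c′ n) (c _)

  cId : Code
  cId = cPair cFst cSnd

  computes-id : Computes cId id
  computes-id n = subst (Eval cId n) (pair-unpair n) (computes-pair computes-fst computes-snd n)

  Total : Code → Set
  Total e = Σ (ℕ → ℕ) (Computes e)

  Computes₂ : Code → (ℕ → ℕ → ℕ) → Set
  Computes₂ e f = ∀ x y → Eval e ⟪ x , y ⟫ (f x y)

  computes₂⇒computes : ∀ {e f} → Computes₂ e f → Computes e (λ n → f (fst n) (snd n))
  computes₂⇒computes {e} {f} c n = subst (λ m → Eval e m (f (fst n) (snd n))) (pair-unpair n) (c (fst n) (snd n))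

  natCase : (ℕ → ℕ) → (ℕ → ℕ) → ℕ → ℕ → ℕ
  natCase f₀ f₁ a zero = f₀ a
  natCase f₀ f₁ a (suc k) = f₁ ⟪ a , k ⟫

  cNatCase : Code → Code → Code
  cNatCase e₀ e₁ = cRec e₀ (cComp e₁ cFst)

  computes-natCase : ∀ {e₀ e₁ f₀ f₁} → Computes e₀ f₀ → Computes e₁ f₁ →
                     Computes₂ (cNatCase e₀ e₁) (natCase f₀ f₁)
  computes-natCase {e₀} c₀ c₁ a zero = eRec0 {e₀} {_} {a} (c₀ a)
  computes-natCase {f₀ = f₀} {f₁} c₀ c₁ a (suc k) =
    eRecS {x = a} {n = k} (computes-natCase c₀ c₁ a k)
          (eComp (eFst {⟪ a , k ⟫} {natCase f₀ f₁ a k}) (c₁ ⟪ a , k ⟫))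

  cIterate : Code → Code
  cIterate e = cRec cId (cComp e cSnd)

  computes-iterate : ∀ {e f} → Computes e f → Computes₂ (cIterate e) (iterate f)
  computes-iterate {e} {f} c x k = subst (Eval (cIterate e) ⟪ x , k ⟫) (iterate-is-fold x f k) (go k)
    where
    go : ∀ k → Eval (cIterate e) ⟪ x , k ⟫ (fold x f k)
    go zero = eRec0 {cId} {_} {x} (computes-id x)
    go (suc k) = eRecS {x = x} {n = k} (go k) (eComp (eSnd {⟪ x , k ⟫} {fold x f k}) (c _))

length≤codeL : ∀ xs → length xs ≤ codeL xs
length≤codeL [] = z≤n
length≤codeL (x ∷ xs) = s≤s (≤-trans (length≤codeL xs) (CantorPairing.snd≤pair x (codeL xs)))

-- A left fold over a coded list runs as a state machine on ⟪ accumulator , remaining list ⟫,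
-- iterated codeL xs ≥ length xs times; the empty list is a fixed point.
module Foldl (e : Code) (f : ℕ → ℕ) (computes-f : Computability.Computes e f) where

  open import Relation.Binary.PropositionalEquality

  open CantorPairing
  open Computability

  _⊛_ : ℕ → ℕ → ℕ
  a ⊛ x = f ⟪ x , a ⟫

  cPop : Code
  cPop = cPair (cComp e (cPair (cComp cFst cSnd) cFst)) (cComp cSnd cSnd)

  cStep : Code
  cStep = cNatCase (cPair cId cZero) cPop

  step : ℕ → ℕ
  step n = natCase (λ a → ⟪ a , 0 ⟫) (λ m → ⟪ f ⟪ fst (snd m) , fst m ⟫ , snd (snd m) ⟫) (fst n) (snd n)

  computes-step : Computes cStep step
  computes-step = computes₂⇒computes (computes-natCase
    (computes-pair computes-id computes-zero)
    (computes-pair (computes-∘ computes-f (computes-pair (computes-∘ computes-fst computes-snd) computes-fst))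
                   (computes-∘ computes-snd computes-snd)))

  -- Values of functions assembled from the combinators are read off direct evaluations, by determinism.
  step-[] : ∀ a → step ⟪ a , 0 ⟫ ≡ ⟪ a , 0 ⟫
  step-[] a = Eval-deterministic (computes-step _) (eRec0 {x = a} (ePair (computes-id a) eZero))

  step-∷ : ∀ a x xs → step ⟪ a , codeL (x ∷ xs) ⟫ ≡ ⟪ a ⊛ x , codeL xs ⟫
  step-∷ a x xs = Eval-deterministic (computes-step _)
    (eRecS {x = a} {n = ⟪ x , r ⟫} (computes-step ⟪ a , ⟪ x , r ⟫ ⟫)
           (eComp (eFst {⟪ a , ⟪ x , r ⟫ ⟫}) pop))
    where
    r = codeL xs
    pop : Eval cPop ⟪ a , ⟪ x , r ⟫ ⟫ ⟪ a ⊛ x , r ⟫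
    pop = ePair (eComp (ePair (eComp (eSnd {a}) (eFst {x} {r})) (eFst {a})) (computes-f _))
                (eComp (eSnd {a}) (eSnd {x} {r}))

  iterate-step : ∀ xs a k → length xs ≤ k → iterate step ⟪ a , codeL xs ⟫ k ≡ ⟪ foldl _⊛_ a xs , 0 ⟫
  iterate-step [] a zero _ = refl
  iterate-step [] a (suc k) _ rewrite step-[] a = iterate-step [] a k z≤n
  iterate-step (x ∷ xs) a (suc k) (s≤s len≤k) rewrite step-∷ a x xs = iterate-step xs (a ⊛ x) k len≤k

  cFoldl : Code
  cFoldl = cComp cFst (cComp (cIterate cStep) (cPair cId cSnd))

  eval-foldl-codeL : ∀ a xs → Eval cFoldl ⟪ a , codeL xs ⟫ (foldl _⊛_ a xs)
  eval-foldl-codeL a xs = eComp (eComp (ePair (computes-id _) (eSnd {a})) iterated) (eFst {_} {0})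
    where
    iterated : Eval (cIterate cStep) ⟪ ⟪ a , codeL xs ⟫ , codeL xs ⟫ ⟪ foldl _⊛_ a xs , 0 ⟫
    iterated = subst (Eval (cIterate cStep) _) (iterate-step xs a (codeL xs) (length≤codeL xs))
                     (computes-iterate computes-step ⟪ a , codeL xs ⟫ (codeL xs))

  eval-foldl : {A B : Set} (code : A → ℕ) (letter : B → ℕ) (k : A → B → A) →
               (∀ a x → Eval e ⟪ letter x , code a ⟫ (code (k a x))) →
               ∀ a xs → Eval cFoldl ⟪ code a , codeL (map letter xs) ⟫ (code (foldl k a xs))
  eval-foldl code letter k simulates a xs = subst (Eval cFoldl _) (fused a xs) (eval-foldl-codeL (code a) (map letter xs))
    where
    fused : ∀ a xs → foldl _⊛_ (code a) (map letter xs) ≡ code (foldl k a xs)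
    fused a [] = refl
    fused a (x ∷ xs) =
      trans (cong (λ c → foldl _⊛_ c (map letter xs)) (Eval-deterministic (computes-f _) (simulates a x)))
            (fused (k a x) xs)

module LetterCodes where

  open import Relation.Binary.PropositionalEquality

  open CantorPairing
  open Computability

  letter : ℕ × Bool → ℕ
  letter (i , b) = 2 * i + bit b

  codeL-map-letter : ∀ w → codeL (map letter w) ≡ codeF w
  codeL-map-letter [] = refl
  codeL-map-letter (ℓ ∷ w) = cong (λ c → suc ⟪ letter ℓ , c ⟫) (codeL-map-letter w)

  iterate-2+ : ∀ m n → iterate (λ k → 2 + k) m n ≡ 2 * n + m
  iterate-2+ m n = trans (sym (iterate-is-fold m _ n)) (go n)
    where
    go : ∀ n → fold m (λ k → 2 + k) n ≡ 2 * n + m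
    go zero = refl
    go (suc n) = trans (cong (2 +_) (go n)) (cong (_+ m) (sym (*-suc 2 n)))

  cPositiveLetter : Code
  cPositiveLetter = cComp (cIterate (cComp cSucc cSucc)) (cPair (cComp cSucc cZero) cId)

  computes-positiveLetter : Computes cPositiveLetter (λ i → letter (i , true))
  computes-positiveLetter i =
    eComp (ePair (eComp eZero eSucc) (computes-id i))
          (subst (Eval _ ⟪ 1 , i ⟫) (iterate-2+ 1 i) (computes-iterate (computes-∘ computes-suc computes-suc) 1 i))

  cPrependPositive : Code
  cPrependPositive = cComp cSucc (cPair (cComp cPositiveLetter cFst) cSnd)

  computes-prependPositive : Computes cPrependPositive (λ n → suc ⟪ letter (fst n , true) , snd n ⟫)
  computes-prependPositive =
    computes-∘ computes-suc (computes-pair (computes-∘ computes-positiveLetter computes-fst) computes-snd)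

  eval-prependPositive : ∀ i w → Eval cPrependPositive ⟪ i , codeF w ⟫ (codeF ((i , true) ∷ w))
  eval-prependPositive i w = eComp (ePair (eComp (eFst {i} {codeF w}) (computes-positiveLetter i)) (eSnd {i})) eSucc

  -- halving runs through the states ⟪ i , 0 ⟫ ↦ ⟪ i , 1 ⟫ ↦ ⟪ suc i , 0 ⟫
  cToggle : Code
  cToggle = cNatCase (cPair cId (cComp cSucc cZero)) (cPair (cComp cSucc cFst) cZero)

  toggle : ℕ → ℕ
  toggle n = natCase (λ i → ⟪ i , 1 ⟫) (λ m → ⟪ suc (fst m) , 0 ⟫) (fst n) (snd n)

  computes-toggle : Computes cToggle toggle
  computes-toggle = computes₂⇒computes (computes-natCase
    (computes-pair computes-id (computes-∘ computes-suc computes-zero))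
    (computes-pair (computes-∘ computes-suc computes-fst) computes-zero))

  toggle-0 : ∀ i → toggle ⟪ i , 0 ⟫ ≡ ⟪ i , 1 ⟫
  toggle-0 i = Eval-deterministic (computes-toggle _) (eRec0 {x = i} (ePair (computes-id i) (eComp eZero eSucc)))

  toggle-1 : ∀ i → toggle ⟪ i , 1 ⟫ ≡ ⟪ suc i , 0 ⟫
  toggle-1 i = Eval-deterministic (computes-toggle _)
    (eRecS {x = i} {n = 0} (eRec0 (ePair (computes-id i) (eComp eZero eSucc)))
           (eComp (eFst {⟪ i , 0 ⟫}) (ePair (eComp (eFst {i} {0}) eSucc) eZero)))

  halve : ℕ → ℕ
  halve = fold ⟪ 0 , 0 ⟫ toggle

  halve-2* : ∀ i → halve (2 * i) ≡ ⟪ i , 0 ⟫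
  halve-2* zero = refl
  halve-2* (suc i) = begin
    halve (2 * suc i)               ≡⟨ cong halve (*-suc 2 i) ⟩
    toggle (toggle (halve (2 * i))) ≡⟨ cong (λ s → toggle (toggle s)) (halve-2* i) ⟩
    toggle (toggle ⟪ i , 0 ⟫)       ≡⟨ cong toggle (toggle-0 i) ⟩
    toggle ⟪ i , 1 ⟫                ≡⟨ toggle-1 i ⟩
    ⟪ suc i , 0 ⟫                   ∎
    where open ≡-Reasoning

  halve-letter : ∀ ℓ → halve (letter ℓ) ≡ ⟪ proj₁ ℓ , bit (proj₂ ℓ) ⟫
  halve-letter (i , false) rewrite +-identityʳ (2 * i) = halve-2* i
  halve-letter (i , true) = trans (cong halve (+-comm (2 * i) 1)) (trans (cong toggle (halve-2* i)) (toggle-0 i))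

  cHalve : Code
  cHalve = cComp (cIterate cToggle) (cPair (cPair cZero cZero) cId)

  total-halve : Total cHalve
  total-halve = _ , computes-∘ (computes₂⇒computes (computes-iterate computes-toggle))
                               (computes-pair (computes-pair computes-zero computes-zero) computes-id)

  eval-halve : ∀ ℓ → Eval cHalve (letter ℓ) ⟪ proj₁ ℓ , bit (proj₂ ℓ) ⟫
  eval-halve ℓ = eComp (ePair (ePair eZero eZero) (computes-id _))
    (subst (Eval _ _) (trans (sym (iterate-is-fold _ toggle (letter ℓ))) (halve-letter ℓ))
           (computes-iterate computes-toggle ⟪ 0 , 0 ⟫ (letter ℓ)))

  sortLetter : List ℕ × List ℕ → ℕ × Bool → List ℕ × List ℕ
  sortLetter (A , B) (i , true) = i ∷ A , B
  sortLetter (A , B) (i , false) = A , i ∷ B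

  codeL² : List ℕ × List ℕ → ℕ
  codeL² (A , B) = ⟪ codeL A , codeL B ⟫

  cSplit cPushNegative cPushPositive cSortLetter : Code
  cSplit = cPair (cPair (cComp cFst (cComp cHalve cFst)) cSnd) (cComp cSnd (cComp cHalve cFst))
  cPushNegative = cPair (cComp cFst cSnd) (cComp cSucc (cPair cFst (cComp cSnd cSnd)))
  cPushPositive = cComp (cPair (cComp cSucc (cPair cFst (cComp cFst cSnd))) (cComp cSnd cSnd)) cFst
  cSortLetter = cComp (cNatCase cPushNegative cPushPositive) cSplit

  total-split : Total cSplit
  total-split = _ , computes-pair
    (computes-pair (computes-∘ computes-fst (computes-∘ (proj₂ total-halve) computes-fst)) computes-snd)
    (computes-∘ computes-snd (computes-∘ (proj₂ total-halve) computes-fst))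

  total-pushNegative : Total cPushNegative
  total-pushNegative = _ , computes-pair (computes-∘ computes-fst computes-snd)
    (computes-∘ computes-suc (computes-pair computes-fst (computes-∘ computes-snd computes-snd)))

  total-pushPositive : Total cPushPositive
  total-pushPositive = _ , computes-∘ (computes-pair
    (computes-∘ computes-suc (computes-pair computes-fst (computes-∘ computes-fst computes-snd)))
    (computes-∘ computes-snd computes-snd)) computes-fst

  total-sortLetter : Total cSortLetter
  total-sortLetter = _ , computes-∘
    (computes₂⇒computes (computes-natCase (proj₂ total-pushNegative) (proj₂ total-pushPositive)))
    (proj₂ total-split)

  eval-sortLetter : ∀ AB ℓ → Eval cSortLetter ⟪ letter ℓ , codeL² AB ⟫ (codeL² (sortLetter AB ℓ))
  eval-sortLetter (A , B) (i , b) = eComp split (sorted b)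
    where
    a = codeL A
    c = codeL B
    s = ⟪ a , c ⟫
    split : Eval cSplit ⟪ letter (i , b) , s ⟫ ⟪ ⟪ i , s ⟫ , bit b ⟫
    split = ePair (ePair (eComp (eComp (eFst {_} {s}) (eval-halve (i , b))) (eFst {i} {bit b})) (eSnd {letter (i , b)}))
                  (eComp (eComp (eFst {_} {s}) (eval-halve (i , b))) (eSnd {i} {bit b}))
    pushNegative : Eval cPushNegative ⟪ i , s ⟫ ⟪ a , suc ⟪ i , c ⟫ ⟫
    pushNegative = ePair (eComp (eSnd {i}) (eFst {a} {c}))
                         (eComp (ePair (eFst {i} {s}) (eComp (eSnd {i}) (eSnd {a} {c}))) eSucc)
    sorted : ∀ b → Eval (cNatCase cPushNegative cPushPositive) ⟪ ⟪ i , s ⟫ , bit b ⟫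
                        (codeL² (sortLetter (A , B) (i , b)))
    sorted false = eRec0 {x = ⟪ i , s ⟫} pushNegative
    sorted true = eRecS {x = ⟪ i , s ⟫} {n = 0} (eRec0 pushNegative)
      (eComp (eFst {⟪ ⟪ i , s ⟫ , 0 ⟫}) (eComp (eFst {⟪ i , s ⟫} {0})
        (ePair (eComp (ePair (eFst {i} {s}) (eComp (eSnd {i}) (eFst {a} {c}))) eSucc) (eComp (eSnd {i}) (eSnd {a} {c})))))

module CancellativeGrothendieck (S : CommutativeSemigroup 0ℓ 0ℓ) (cancel : Cancellative S)
                                (s₀ : CommutativeSemigroup.Carrier S) where

  open CommutativeSemigroup S
  open import Algebra.Properties.CommutativeSemigroup S
  open import Relation.Binary.Reasoning.Setoid setoid
  open Grothendieck S

  ∼⇒cross : ∀ {a b c d} → (a , b) ∼ (c , d) → a ∙ d ≈ c ∙ b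
  ∼⇒cross {a} {b} {c} {d} (z , p) = cancel (a ∙ d) (c ∙ b) z p

  cross⇒∼ : ∀ {a b c d} → a ∙ d ≈ c ∙ b → (a , b) ∼ (c , d)
  cross⇒∼ {a} p = a , ∙-congʳ p

  ≈×≈⇒∼ : ∀ {a a′ b b′} → a ≈ a′ → b ≈ b′ → (a , b) ∼ (a′ , b′)
  ≈×≈⇒∼ a≈a′ b≈b′ = cross⇒∼ (∙-cong a≈a′ (sym b≈b′))

  ∼-refl : ∀ {p} → p ∼ p
  ∼-refl = cross⇒∼ refl

  ∼-sym : ∀ {p q} → p ∼ q → q ∼ p
  ∼-sym p∼q = cross⇒∼ (sym (∼⇒cross p∼q))

  ∼-trans : ∀ {p q r} → p ∼ q → q ∼ r → p ∼ r
  ∼-trans {a , b} {c , d} {e , f} p∼q q∼r = cross⇒∼ (cancel (a ∙ f) (e ∙ b) d (begin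
    (a ∙ f) ∙ d ≈⟨ xy∙z≈xz∙y a f d ⟩
    (a ∙ d) ∙ f ≈⟨ ∙-congʳ (∼⇒cross p∼q) ⟩
    (c ∙ b) ∙ f ≈⟨ xy∙z≈xz∙y c b f ⟩
    (c ∙ f) ∙ b ≈⟨ ∙-congʳ (∼⇒cross q∼r) ⟩
    (e ∙ d) ∙ b ≈⟨ xy∙z≈xz∙y e d b ⟩
    (e ∙ b) ∙ d ∎))

  ⊕-cong : ∀ {p p′ q q′} → p ∼ p′ → q ∼ q′ → (p ⊕ q) ∼ (p′ ⊕ q′)
  ⊕-cong {a , b} {a′ , b′} {c , d} {c′ , d′} p∼p′ q∼q′ = cross⇒∼ (begin
    (a ∙ c) ∙ (b′ ∙ d′) ≈⟨ interchange a c b′ d′ ⟩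
    (a ∙ b′) ∙ (c ∙ d′) ≈⟨ ∙-cong (∼⇒cross p∼p′) (∼⇒cross q∼q′) ⟩
    (a′ ∙ b) ∙ (c′ ∙ d) ≈⟨ interchange a′ b c′ d ⟩
    (a′ ∙ c′) ∙ (b ∙ d) ∎)

  ⊖-cong : ∀ {p q} → p ∼ q → (⊖ p) ∼ (⊖ q)
  ⊖-cong {a , b} {c , d} p∼q = cross⇒∼ (trans (comm b c) (trans (sym (∼⇒cross p∼q)) (comm a d)))

  grothendieckGroup : AbelianGroup 0ℓ 0ℓ
  grothendieckGroup = record
    { Carrier = Carrier × Carrier
    ; _≈_ = _∼_
    ; _∙_ = _⊕_
    ; ε = (s₀ , s₀)
    ; _⁻¹ = ⊖_
    ; isAbelianGroup = record
      { isGroup = record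
        { isMonoid = record
          { isSemigroup = record
            { isMagma = record
              { isEquivalence = record { refl = ∼-refl ; sym = ∼-sym ; trans = ∼-trans }
              ; ∙-cong = ⊕-cong }
            ; assoc = λ { (a , b) (c , d) (e , f) → cross⇒∼ (∙-cong (assoc a c e) (sym (assoc b d f))) } }
          ; identity = (λ { (a , b) → cross⇒∼ (xy∙z≈y∙xz s₀ a b) })
                     , (λ { (a , b) → cross⇒∼ (xy∙z≈x∙zy a s₀ b) }) }
        ; inverse = (λ { (a , b) → cross⇒∼ (xy∙z≈z∙yx b a s₀) })
                  , (λ { (a , b) → cross⇒∼ (xy∙z≈z∙yx a b s₀) })
        ; ⁻¹-cong = ⊖-cong }
      ; comm = λ { (a , b) (c , d) → cross⇒∼ (∙-cong (comm a c) (comm d b)) } } }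

  γ-cong : ∀ {a b} → a ≈ b → γ a ∼ γ b
  γ-cong a≈b = cross⇒∼ (∙-cong (∙-cong a≈b a≈b) (sym a≈b))

  γ-homo : ∀ a b → γ (a ∙ b) ∼ (γ a ⊕ γ b)
  γ-homo a b = cross⇒∼ (∙-congʳ (interchange a b a b))

  ≈γ-γ : ∀ a b → (a , b) ∼ (γ a ⊕ (⊖ γ b))
  ≈γ-γ a b = cross⇒∼ (trans (sym (assoc a a (b ∙ b))) (sym (assoc (a ∙ a) b b)))

  ∙ˡ-∼-⊕γ : ∀ g x y → (g ∙ x , y) ∼ ((x , y) ⊕ γ g)
  ∙ˡ-∼-⊕γ g x y = cross⇒∼ (begin
    (g ∙ x) ∙ (y ∙ g)   ≈⟨ ∙-cong (comm g x) (comm y g) ⟩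
    (x ∙ g) ∙ (g ∙ y)   ≈⟨ sym (assoc (x ∙ g) g y) ⟩
    ((x ∙ g) ∙ g) ∙ y   ≈⟨ ∙-congʳ (assoc x g g) ⟩
    (x ∙ (g ∙ g)) ∙ y   ∎)

  ∙ʳ-∼-⊕⊖γ : ∀ g x y → (x , g ∙ y) ∼ ((x , y) ⊕ (⊖ γ g))
  ∙ʳ-∼-⊕⊖γ g x y = ⊖-cong (∙ˡ-∼-⊕γ g y x)

  ≈⇒∼ε : ∀ {x y} → x ≈ y → (x , y) ∼ (s₀ , s₀)
  ≈⇒∼ε {x} {y} x≈y = cross⇒∼ (trans (∙-congʳ x≈y) (comm y s₀))

  ∼ε⇒≈ : ∀ {x y} → (x , y) ∼ (s₀ , s₀) → x ≈ y
  ∼ε⇒≈ {x} {y} x,y∼ε = cancel x y s₀ (trans (∼⇒cross x,y∼ε) (comm s₀ y))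

module GeneratorPresentation (S : CommutativeSemigroup 0ℓ 0ℓ) (cancel : Cancellative S)
                             (PS : SemigroupPresentation S) where

  open CommutativeSemigroup S
  open SemigroupPresentation PS
  open Grothendieck S

  s₀ : Carrier
  s₀ = ν (0 ∷ [])

  open CancellativeGrothendieck S cancel s₀ public
  open LetterCodes using (letter; codeL-map-letter; cPrependPositive; computes-prependPositive; eval-prependPositive;
                          sortLetter; codeL²; cSortLetter; total-sortLetter; eval-sortLetter)
  module 𝒢 = AbelianGroup grothendieckGroup
  open import Relation.Binary.Reasoning.Setoid 𝒢.setoid

  gen : ℕ → Carrier
  gen i = ν (i ∷ [])

  signed : Bool → Carrier × Carrier → Carrier × Carrier
  signed true p = p
  signed false p = ⊖ p

  signed-cong : ∀ b {p q} → p ∼ q → signed b p ∼ signed b q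
  signed-cong true p∼q = p∼q
  signed-cong false p∼q = ⊖-cong p∼q

  signed-⊕ : ∀ b p q → signed b (p ⊕ q) ∼ (signed b p ⊕ signed b q)
  signed-⊕ true p q = ∼-refl
  signed-⊕ false p q = ∼-refl

  ν𝒢 : FWord → Carrier × Carrier
  ν𝒢 [] = s₀ , s₀
  ν𝒢 ((i , b) ∷ w) = signed b (γ (gen i)) ⊕ ν𝒢 w

  ν𝒢-++ : ∀ u v → ν𝒢 (u ++ v) ∼ (ν𝒢 u ⊕ ν𝒢 v)
  ν𝒢-++ [] v = 𝒢.sym (𝒢.identityˡ (ν𝒢 v))
  ν𝒢-++ ((i , b) ∷ u) v = 𝒢.trans (𝒢.∙-congˡ (ν𝒢-++ u v)) (𝒢.sym (𝒢.assoc _ (ν𝒢 u) (ν𝒢 v)))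

  prependSigned : Bool → FWord → ℕ → FWord
  prependSigned b w i = (i , b) ∷ w

  -- the word computed from a label by a left fold, hence reversed
  signedWord : Bool → DWord → FWord
  signedWord b (x ∷ xs) = foldl (prependSigned b) ((x , b) ∷ []) xs

  ν𝒢-foldl-prependSigned : ∀ b xs y ws →
    ν𝒢 (foldl (prependSigned b) ((y , b) ∷ ws) xs) ∼ (signed b (γ (ν (y ∷ xs))) ⊕ ν𝒢 ws)
  ν𝒢-foldl-prependSigned b [] y ws = ∼-refl
  ν𝒢-foldl-prependSigned b (x ∷ xs) y ws = begin
    ν𝒢 (foldl (prependSigned b) ((x , b) ∷ (y , b) ∷ ws) xs)
      ≈⟨ ν𝒢-foldl-prependSigned b xs x ((y , b) ∷ ws) ⟩
    signed b (γ (ν (x ∷ xs))) ⊕ (signed b (γ (gen y)) ⊕ ν𝒢 ws)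
      ≈⟨ 𝒢.sym (𝒢.assoc _ _ _) ⟩
    (signed b (γ (ν (x ∷ xs))) ⊕ signed b (γ (gen y))) ⊕ ν𝒢 ws
      ≈⟨ 𝒢.∙-congʳ (𝒢.sym (signed-⊕ b _ _)) ⟩
    signed b (γ (ν (x ∷ xs)) ⊕ γ (gen y)) ⊕ ν𝒢 ws
      ≈⟨ 𝒢.∙-congʳ (signed-cong b (𝒢.sym (γ-homo _ _))) ⟩
    signed b (γ (ν (x ∷ xs) ∙ gen y)) ⊕ ν𝒢 ws
      ≈⟨ 𝒢.∙-congʳ (signed-cong b (γ-cong (trans (comm _ _) (sym (hom (y ∷ []) (x ∷ xs)))))) ⟩
    signed b (γ (ν (y ∷ x ∷ xs))) ⊕ ν𝒢 ws
      ∎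

  ν𝒢-signedWord : ∀ b w → ν𝒢 (signedWord b w) ∼ signed b (γ (ν w))
  ν𝒢-signedWord b (x ∷ xs) = 𝒢.trans (ν𝒢-foldl-prependSigned b xs x []) (𝒢.identityʳ _)

  grothendieckPresentation : GroupPresentation 𝒢.rawGroup
  grothendieckPresentation = record
    { ν = ν𝒢
    ; hom-ε = ∼-refl
    ; hom = ν𝒢-++
    ; hom-inv = λ _ → ∼-refl
    ; surj = λ (a , b) → let (wa , νwa≈a) = surj a ; (wb , νwb≈b) = surj b in
        signedWord true wa ++ signedWord false wb , (begin
          ν𝒢 (signedWord true wa ++ signedWord false wb)
            ≈⟨ ν𝒢-++ (signedWord true wa) (signedWord false wb) ⟩
          ν𝒢 (signedWord true wa) ⊕ ν𝒢 (signedWord false wb)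
            ≈⟨ 𝒢.∙-cong (ν𝒢-signedWord true wa) (ν𝒢-signedWord false wb) ⟩
          γ (ν wa) ⊕ (⊖ γ (ν wb))
            ≈⟨ 𝒢.∙-cong (γ-cong νwa≈a) (⊖-cong (γ-cong νwb≈b)) ⟩
          γ a ⊕ (⊖ γ b)
            ≈⟨ 𝒢.sym (≈γ-γ a b) ⟩
          (a , b)
            ∎) }

  γ-isSemigroupHom : IsSemigroupHom S grothendieckGroup γ
  γ-isSemigroupHom = (λ _ _ → γ-cong) , γ-homo

  module FoldPositive = Foldl cPrependPositive _ computes-prependPositive

  cγ : Code
  cγ = cComp FoldPositive.cFoldl (cPair (cComp cPrependPositive (cPair cFst cZero)) cSnd)

  γ-index : IsIndexOf codeD codeF ν ν𝒢 _∼_ γ cγ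
  γ-index (x ∷ xs) = signedWord true (x ∷ xs) , eval-cγ , ν𝒢-signedWord true (x ∷ xs)
    where
    open import Relation.Binary.PropositionalEquality using (subst)
    open import Data.List.Properties using (map-id)
    eval-cγ : Eval cγ ⟪ x , codeL xs ⟫ (codeF (signedWord true (x ∷ xs)))
    eval-cγ = eComp (ePair (eComp (ePair (eFst {x} {codeL xs}) eZero) (eval-prependPositive x []))
                           (eSnd {x} {codeL xs}))
      (subst (λ c → Eval FoldPositive.cFoldl ⟪ codeF ((x , true) ∷ []) , codeL c ⟫ (codeF (signedWord true (x ∷ xs))))
             (map-id xs)
        (FoldPositive.eval-foldl codeF id (prependSigned true) (λ w i → eval-prependPositive i w)
                                 ((x , true) ∷ []) xs))

  -- The extra letter x₀ makes the label nonempty; it adds s₀ to both components of νL², which cancels.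
  νL : List ℕ → Carrier
  νL L = ν (0 ∷ L)

  νL-∷ : ∀ i L → νL (i ∷ L) ≈ gen i ∙ νL L
  νL-∷ i [] = trans (hom (0 ∷ []) (i ∷ [])) (comm s₀ (gen i))
  νL-∷ i (j ∷ L) = S.begin
    ν (0 ∷ i ∷ j ∷ L)          S.≈⟨ hom (0 ∷ []) (i ∷ j ∷ L) ⟩
    s₀ ∙ ν (i ∷ j ∷ L)         S.≈⟨ ∙-congˡ (hom (i ∷ []) (j ∷ L)) ⟩
    s₀ ∙ (gen i ∙ ν (j ∷ L))   S.≈⟨ x∙yz≈y∙xz s₀ (gen i) (ν (j ∷ L)) ⟩
    gen i ∙ (s₀ ∙ ν (j ∷ L))   S.≈⟨ ∙-congˡ (sym (hom (0 ∷ []) (j ∷ L))) ⟩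
    gen i ∙ ν (0 ∷ j ∷ L)      S.∎
    where
    open import Algebra.Properties.CommutativeSemigroup S using (x∙yz≈y∙xz)
    import Relation.Binary.Reasoning.Setoid setoid as S

  νL² : List ℕ × List ℕ → Carrier × Carrier
  νL² (A , B) = νL A , νL B

  νL²-sortLetter : ∀ AB i b → νL² (sortLetter AB (i , b)) ∼ (νL² AB ⊕ signed b (γ (gen i)))
  νL²-sortLetter (A , B) i true = 𝒢.trans (≈×≈⇒∼ (νL-∷ i A) refl) (∙ˡ-∼-⊕γ (gen i) (νL A) (νL B))
  νL²-sortLetter (A , B) i false = 𝒢.trans (≈×≈⇒∼ refl (νL-∷ i B)) (∙ʳ-∼-⊕⊖γ (gen i) (νL A) (νL B))

  νL²-foldl-sortLetter : ∀ w AB → νL² (foldl sortLetter AB w) ∼ (νL² AB ⊕ ν𝒢 w)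
  νL²-foldl-sortLetter [] AB = 𝒢.sym (𝒢.identityʳ (νL² AB))
  νL²-foldl-sortLetter ((i , b) ∷ w) AB = begin
    νL² (foldl sortLetter (sortLetter AB (i , b)) w) ≈⟨ νL²-foldl-sortLetter w _ ⟩
    νL² (sortLetter AB (i , b)) ⊕ ν𝒢 w              ≈⟨ 𝒢.∙-congʳ (νL²-sortLetter AB i b) ⟩
    (νL² AB ⊕ signed b (γ (gen i))) ⊕ ν𝒢 w          ≈⟨ 𝒢.assoc _ _ _ ⟩
    νL² AB ⊕ ν𝒢 ((i , b) ∷ w)                       ∎

  sortWord : List ℕ × List ℕ → FWord → List ℕ × List ℕ
  sortWord = foldl sortLetter

  sortPair : FWord → FWord → List ℕ × List ℕ
  sortPair u v = sortWord (swap (sortWord ([] , []) u)) v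

  νL²-sortPair : ∀ u v → νL² (sortPair u v) ∼ ((⊖ ν𝒢 u) ⊕ ν𝒢 v)
  νL²-sortPair u v = 𝒢.trans (νL²-foldl-sortLetter v _)
    (𝒢.∙-congʳ (⊖-cong (𝒢.trans (νL²-foldl-sortLetter u ([] , [])) (𝒢.identityˡ (ν𝒢 u)))))

  ν𝒢-∼⇔sortPair-≈ : ∀ u v → ν𝒢 u ∼ ν𝒢 v ⇔ νL (proj₁ (sortPair u v)) ≈ νL (proj₂ (sortPair u v))
  ν𝒢-∼⇔sortPair-≈ u v = mk⇔
    (λ u∼v → ∼ε⇒≈ (𝒢.trans (νL²-sortPair u v)
                             (𝒢.trans (𝒢.comm _ _) (x≈y⇒x∙y⁻¹≈ε (𝒢.sym u∼v)))))
    (λ X≈Y → 𝒢.sym (x∙y⁻¹≈ε⇒x≈y (ν𝒢 v) (ν𝒢 u)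
               (𝒢.trans (𝒢.comm _ _) (𝒢.trans (𝒢.sym (νL²-sortPair u v)) (≈⇒∼ε X≈Y)))))
    where open import Algebra.Properties.Group 𝒢.group using (x∙y⁻¹≈ε⇒x≈y; x≈y⇒x∙y⁻¹≈ε)

  module FoldSort = Foldl cSortLetter _ (proj₂ total-sortLetter)

  eval-sortWord : ∀ AB w → Eval FoldSort.cFoldl ⟪ codeL² AB , codeF w ⟫ (codeL² (sortWord AB w))
  eval-sortWord AB w =
    subst (λ c → Eval FoldSort.cFoldl ⟪ codeL² AB , c ⟫ (codeL² (sortWord AB w))) (codeL-map-letter w)
    (FoldSort.eval-foldl codeL² letter sortLetter eval-sortLetter AB w)
    where open import Relation.Binary.PropositionalEquality using (subst)

  cSortFirst cSortPair cSortPairLabels : Code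
  cSortFirst = cComp FoldSort.cFoldl (cPair (cPair cZero cZero) cFst)
  cSortPair = cComp FoldSort.cFoldl (cPair (cComp (cPair cSnd cFst) cSortFirst) cSnd)
  cSortPairLabels = cComp (cPair (cPair cZero cFst) (cPair cZero cSnd)) cSortPair

  eval-sortPairLabels : ∀ u v → Eval cSortPairLabels ⟪ codeF u , codeF v ⟫
                                      ⟪ codeD (0 ∷ proj₁ (sortPair u v)) , codeD (0 ∷ proj₂ (sortPair u v)) ⟫
  eval-sortPairLabels u v = eComp (eComp (ePair (eComp first swapped) (eSnd {codeF u})) (eval-sortWord _ v)) labels
    where
    AB = sortWord ([] , []) u
    first : Eval cSortFirst ⟪ codeF u , codeF v ⟫ (codeL² AB)
    first = eComp (ePair (ePair eZero eZero) (eFst {codeF u} {codeF v})) (eval-sortWord ([] , []) u)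
    swapped : Eval (cPair cSnd cFst) (codeL² AB) (codeL² (swap AB))
    swapped = ePair (eSnd {codeL (proj₁ AB)}) (eFst {codeL (proj₁ AB)} {codeL (proj₂ AB)})
    XY = sortPair u v
    labels : Eval (cPair (cPair cZero cFst) (cPair cZero cSnd)) (codeL² XY)
                  ⟪ codeD (0 ∷ proj₁ XY) , codeD (0 ∷ proj₂ XY) ⟫
    labels = ePair (ePair eZero (eFst {codeL (proj₁ XY)} {codeL (proj₂ XY)}))
                   (ePair eZero (eSnd {codeL (proj₁ XY)} {codeL (proj₂ XY)}))

  grothendieckPresentation-computable : IsComputableSemigroupPres PS → IsComputableGroupPres grothendieckPresentation
  grothendieckPresentation-computable computable =
    Computability.computable-by-reduction {code = codeF} {code′ = codeD} computable cSortPairLabels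
      (λ u v → 0 ∷ proj₁ (sortPair u v) , 0 ∷ proj₂ (sortPair u v) ,
               eval-sortPairLabels u v , ν𝒢-∼⇔sortPair-≈ u v)


proposition2p18 : (S : CommutativeSemigroup 0ℓ 0ℓ) → Cancellative S →
    (PS : SemigroupPresentation S) → IsComputableSemigroupPres PS →
    (PG : GroupPresentation (𝒢of S PS)) → IsCEGroupPres PG →
    IsUniversal S PS PG →
    IsComputableGroupPres PG
proposition2p18 S cancel PS computable PG _ (_ , universal) =
  computable-along-identity 𝒢.isEquivalence computable-𝒢 (proj₁ identity-index) (proj₂ identity-index)
  where
  open GeneratorPresentation S cancel PS
  open Grothendieck S using (γ; _∼_)
  open Computability using (computable-along-identity; computable⇒ce)

  computable-𝒢 : IsComputableGroupPres grothendieckPresentation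
  computable-𝒢 = grothendieckPresentation-computable computable

  -- the identity of 𝒢(S) is the ψ induced by φ = γ
  identity-index : Σ Code (IsIndexOf codeF codeF (GroupPresentation.ν PG) ν𝒢 _∼_ id)
  identity-index =
    let (_ , induced) = universal grothendieckGroup grothendieckPresentation (computable⇒ce {code = codeF} computable-𝒢)
        (e′ , _ , index) = induced γ γ-isSemigroupHom cγ γ-index
                                   id ((λ _ _ → id) , (λ _ _ → ∼-refl)) (λ _ → ∼-refl)
    in e′ , index
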